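{- Let $I\subseteq\mathbb{K}[x_1,\dots,x_d]$ be an ideal generated by pure difference binomials $p_1,\dots,p_k$, let $L\subseteq\mathbb{Z}^d$ be the lattice spanned by their exponent vectors, and let $J$ be the ideal generated by the canonical binomials of these exponent vectors. (1) If $k=1$ and $I=\langle p\rangle$ where $p$ is a canonical pure difference binomial, then $I=I_L$; if moreover $p$ is irreducible, then $I=I_{\mathrm{Sat}(L)}$. (2) If at least one of $p_1,\dots,p_k$ has an exponent vector in $\mathbb{Z}_{>0}^d$, then $J=I_L$.
   Context: $\mathbb{K}=\overline{\mathbb{Q}}$. A pure difference binomial is $x^{\alpha}-x^{\beta}$ with $\alpha,\beta\in\mathbb{N}^d$; its exponent vector is $\alpha-\beta$. For $v\in\mathbb{Z}^d$, let $v_+=(\max\{v_1,0\},\dots,\max\{v_d,0\})$ and $v_-=v_+-v$; the canonical binomial of $v$ is $x^{v_+}-x^{v_- }$, and a pure difference binomial is canonical if it equals the canonical binomial of its exponent vector. $\mathrm{Sat}(L)=\{u\in\mathbb{Z}^d: cu\in L\text{ for some }c\in\mathbb{Z}\setminus\{0\}\}$; for a lattice $L'$, $I_{L'}=\langle x^{\alpha}-x^{\beta}:\alpha,\beta\in\mathbb{N}^d,\ \alpha-\beta\in L'\rangle$. -}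

module Defs where

open import Level using (Level; _⊔_) renaming (suc to lsuc)
open import Algebra.Bundles using (CommutativeRing)
open import Data.Nat as ℕ using (ℕ; zero; suc; _≤_)
open import Data.Integer as ℤ using (ℤ; +_; -[1+_])
open import Data.Fin using (Fin; zero; suc)
open import Data.Vec as Vec using (Vec; []; _∷_)
open import Data.Vec.Relation.Unary.All using (All)
open import Data.Vec.Properties using (≡-dec)
open import Data.List as List using (List; []; _∷_; _++_; length)
open import Data.Product using (Σ; ∃; _×_; _,_; proj₁; proj₂)
open import Data.Sum using (_⊎_)
open import Relation.Nullary using (¬_; yes; no)
open import Relation.Binary.PropositionalEquality using (_≡_; _≢_)

evalU : ∀ {c ℓ} (R : CommutativeRing c ℓ) → List (CommutativeRing.Carrier R) →
        CommutativeRing.Carrier R → CommutativeRing.Carrier R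
evalU R [] x = CommutativeRing.0# R
evalU R (a ∷ as) x = a + x * evalU R as x
  where open CommutativeRing R

natK : ∀ {c ℓ} (R : CommutativeRing c ℓ) → ℕ → CommutativeRing.Carrier R
natK R zero = CommutativeRing.0# R
natK R (suc n) = CommutativeRing._+_ R (CommutativeRing.1# R) (natK R n)

record ACF0 (c ℓ : Level) : Set (lsuc (c ⊔ ℓ)) where
  field
    cring : CommutativeRing c ℓ
  open CommutativeRing cring using (Carrier; _≈_; _+_; _*_; -_; 0#; 1#)
  field
    0≉1       : ¬ (0# ≈ 1#)
    inverse   : ∀ x → ¬ (x ≈ 0#) → Σ Carrier λ y → x * y ≈ 1#
    -- every univariate polynomial of degree ≥ 1 has a root
    algClosed : ∀ (as : List Carrier) (a : Carrier) → 1 ≤ length as → ¬ (a ≈ 0#) →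
                Σ Carrier λ r → evalU cring (as ++ (a ∷ [])) r ≈ 0#
    char0     : ∀ n → ¬ (natK cring (suc n) ≈ 0#)

module Binomials {c ℓ : Level} (K : ACF0 c ℓ) (d : ℕ) where
  open ACF0 K using (cring)
  open CommutativeRing cring using (Carrier; _≈_; _+_; _*_; -_; 0#; 1#)

  Exp : Set
  Exp = Vec ℕ d

  -- a polynomial is a finite list of terms (coefficient, exponent);
  -- polynomials are compared through their coefficient functions
  Poly : Set c
  Poly = List (Carrier × Exp)

  coeff : Poly → Exp → Carrier
  coeff [] α = 0#
  coeff ((a , β) ∷ p) α with ≡-dec ℕ._≟_ β α
  ... | yes _ = a + coeff p α
  ... | no  _ = coeff p α

  infix 4 _≈ₚ_
  _≈ₚ_ : Poly → Poly → Set ℓ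
  p ≈ₚ q = ∀ α → coeff p α ≈ coeff q α

  0ₚ 1ₚ : Poly
  0ₚ = []
  1ₚ = (1# , Vec.replicate d 0) ∷ []

  _+ₚ_ : Poly → Poly → Poly
  p +ₚ q = p ++ q

  -ₚ_ : Poly → Poly
  -ₚ p = List.map (λ t → (- proj₁ t) , proj₂ t) p

  _*ₚ_ : Poly → Poly → Poly
  p *ₚ q = List.concatMap (λ s → List.map (λ t → (proj₁ s * proj₁ t) ,
                 Vec.zipWith ℕ._+_ (proj₂ s) (proj₂ t)) q) p

  sumₚ : List Poly → Poly
  sumₚ = List.foldr _+ₚ_ 0ₚ

  mono : Exp → Poly
  mono α = (1# , α) ∷ []

  binom : Exp → Exp → Poly
  binom α β = mono α +ₚ (-ₚ mono β)

  ⟨_⟩ : ∀ {g} → (Poly → Set g) → Poly → Set (c ⊔ ℓ ⊔ g)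
  ⟨ G ⟩ f = Σ (List (Poly × Σ Poly G)) λ cs →
              f ≈ₚ sumₚ (List.map (λ t → proj₁ t *ₚ proj₁ (proj₂ t)) cs)

  infix 4 _≐_
  _≐_ : ∀ {a b} → (Poly → Set a) → (Poly → Set b) → Set (c ⊔ a ⊔ b)
  P ≐ Q = ∀ f → (P f → Q f) × (Q f → P f)

  unit : Poly → Set (c ⊔ ℓ)
  unit f = Σ Poly λ h → (f *ₚ h) ≈ₚ 1ₚ

  Irreducible : Poly → Set (c ⊔ ℓ)
  Irreducible p = (¬ (p ≈ₚ 0ₚ)) × (¬ unit p) ×
                  (∀ f g → p ≈ₚ (f *ₚ g) → unit f ⊎ unit g)

  ZVec : Set
  ZVec = Vec ℤ d

  expVec : Exp → Exp → ZVec
  expVec α β = Vec.zipWith (λ a b → + a ℤ.- + b) α β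

  posPart negPart : ℤ → ℕ
  posPart (+ n) = n
  posPart -[1+ n ] = 0
  negPart (+ n) = 0
  negPart -[1+ n ] = suc n

  canBinom : ZVec → Poly
  canBinom v = binom (Vec.map posPart v) (Vec.map negPart v)

  IsCanonical : Exp → Exp → Set ℓ
  IsCanonical α β = binom α β ≈ₚ canBinom (expVec α β)

  lincomb : ∀ {k} → (Fin k → ℤ) → (Fin k → ZVec) → ZVec
  lincomb {zero}  cs vs = Vec.replicate d (+ 0)
  lincomb {suc k} cs vs = Vec.zipWith ℤ._+_ (Vec.map (cs zero ℤ.*_) (vs zero))
                                             (lincomb (λ i → cs (suc i)) (λ i → vs (suc i)))

  Span : ∀ {k} → (Fin k → ZVec) → ZVec → Set
  Span vs u = Σ (Fin _ → ℤ) λ cs → u ≡ lincomb cs vs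

  Sat : (ZVec → Set) → ZVec → Set
  Sat L u = Σ ℤ λ m → (m ≢ + 0) × L (Vec.map (m ℤ.*_) u)

  I[_] : (ZVec → Set) → Poly → Set (c ⊔ ℓ)
  I[ L ] = ⟨ (λ f → Σ Exp λ α → Σ Exp λ β → L (expVec α β) × f ≡ binom α β) ⟩

  BinIdeal : ∀ {k} → (Fin k → Exp) → (Fin k → Exp) → Poly → Set (c ⊔ ℓ)
  BinIdeal αs βs = ⟨ (λ f → Σ (Fin _) λ i → f ≡ binom (αs i) (βs i)) ⟩

  CanIdeal : ∀ {k} → (Fin k → ZVec) → Poly → Set (c ⊔ ℓ)
  CanIdeal vs = ⟨ (λ f → Σ (Fin _) λ i → f ≡ canBinom (vs i)) ⟩

  Positive : ZVec → Set
  Positive v = All (λ z → + 0 ℤ.< z) v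

{-# OPTIONS --safe #-}
-- Write α ~ β when x^α − x^β lies in the ideal at hand. This is an equivalence relation
-- on exponent vectors that is stable under translation, hence under scaling, so u₊ ~ u₋
-- gives a ~ b whenever a − b is an integer multiple of u; this settles the principal case.
-- For the saturation, m(a − b) = c·v means that either a − b is already a multiple of v,
-- or v = k·w with k ≥ 2; then x^(k w₊) − x^(k w₋) = (x^(w₊) − x^(w₋)) · Σ_{i+j=k−1} x^(i w₊ + j w₋)
-- factors p into non-units (the first factor vanishes at (1,…,1), the second where one
-- coordinate t satisfies t^|w_j| = ζ with 1 + ζ + ⋯ + ζ^(k−1) = 0), contradicting irreducibility.
-- When some generator has a positive exponent vector W, we get W ~ 0, so translating a and b by
-- a large multiple of W keeps every partial sum of a ℤ-combination of the exponent vectors in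
-- ℕ^d, and the combination can be walked one generator at a time.
module Submission where

open import Level using (Level; _⊔_)
open import Algebra.Bundles using (CommutativeRing)
open import Data.Nat as ℕ using (ℕ; zero; suc; z≤n; s≤s; NonZero)
import Data.Nat.Properties as ℕP
open import Data.Nat.Divisibility as ℕD using (divides)
open import Data.Nat.DivMod using (_/_; m/n*n≡m)
open import Data.Nat.GCD using (gcd; gcd[m,n]∣m; gcd[m,n]∣n; gcd[m,n]≢0; m/gcd[m,n]≢0)
open import Data.Nat.Coprimality using (coprime-/gcd; coprime-divisor)
open import Data.Integer as ℤ using (ℤ; +_; -[1+_])
import Data.Integer.Properties as ℤP
import Data.Integer.Divisibility.Signed as ℤD
open import Data.Integer.Tactic.RingSolver using (solve-∀)
open import Data.Fin using (Fin; zero; suc)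
open import Data.Vec as Vec using (Vec; []; _∷_)
import Data.Vec.Properties as VecP
open import Data.Vec.Relation.Unary.All as All using (All; []; _∷_)
open import Data.List as List using (List; []; _∷_; _++_; length)
import Data.List.Properties as ListP
open import Data.Product using (Σ; _×_; _,_; proj₁; proj₂)
open import Data.Sum using (_⊎_; inj₁; inj₂; [_,_])
open import Data.Empty using (⊥-elim)
open import Data.List.Relation.Binary.Pointwise as Pointwise using (Pointwise; []; _∷_)
open import Data.Product.Relation.Binary.Pointwise.NonDependent using () renaming (Pointwise to ×-Pointwise)
open import Relation.Nullary using (¬_; yes; no)
open import Relation.Binary.Bundles using (Setoid)
open import Relation.Binary.PropositionalEquality as ≡ using (_≡_; _≢_; cong; cong₂)

open import Defs

-- Integer and natural-number vectors

gcd-nonZero : ∀ m n .{{_ : NonZero m}} → NonZero (gcd m n)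
gcd-nonZero m n = ℕ.≢-nonZero (gcd[m,n]≢0 m n (inj₁ (ℕ.≢-nonZero⁻¹ m)))

module _ (m n : ℕ) .{{_ : NonZero m}} where
  private instance
    _ = gcd-nonZero m n

  m/gcd[m,n]≥2 : ¬ (m ℕD.∣ n) → 2 ℕ.≤ m / gcd m n
  m/gcd[m,n]≥2 m∤n with m / gcd m n | m/gcd[m,n]≢0 m n | m/n*n≡m (gcd[m,n]∣m m n)
  ... | zero        | m/g≢0 | _   = ⊥-elim (m/g≢0 ≡.refl)
  ... | suc zero    | _     | g≡m =
    ⊥-elim (m∤n (≡.subst (ℕD._∣ n) (≡.trans (≡.sym (ℕP.+-identityʳ _)) g≡m) (gcd[m,n]∣n m n)))
  ... | suc (suc _) | _     | _   = s≤s (s≤s z≤n)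

  m*a≡n*b⇒m/gcd[m,n]∣b : ∀ {a b} → m ℕ.* a ≡ n ℕ.* b → m / gcd m n ℕD.∣ b
  m*a≡n*b⇒m/gcd[m,n]∣b {a} {b} eq =
    coprime-divisor (coprime-/gcd m n) (divides a (≡.trans (≡.sym reduced) (ℕP.*-comm m′ a)))
    where
    open ≡.≡-Reasoning
    open import Algebra.Properties.CommutativeSemigroup ℕP.*-commutativeSemigroup using (xy∙z≈xz∙y)
    g = gcd m n
    m′ = m / g
    n′ = n / g
    reduced : m′ ℕ.* a ≡ n′ ℕ.* b
    reduced = ℕP.*-cancelʳ-≡ _ _ g (begin
      m′ ℕ.* a ℕ.* g   ≡⟨ xy∙z≈xz∙y m′ a g ⟩
      m′ ℕ.* g ℕ.* a   ≡⟨ cong (ℕ._* a) (m/n*n≡m (gcd[m,n]∣m m n)) ⟩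
      m ℕ.* a          ≡⟨ eq ⟩
      n ℕ.* b          ≡⟨ cong (ℕ._* b) (m/n*n≡m (gcd[m,n]∣n m n)) ⟨
      n′ ℕ.* g ℕ.* b   ≡⟨ xy∙z≈xz∙y n′ g b ⟩
      n′ ℕ.* b ℕ.* g   ∎)

infixr 7 _·_
_·_ : ∀ {n} → ℤ → Vec ℤ n → Vec ℤ n
k · v = Vec.map (k ℤ.*_) v

·-identityˡ : ∀ {n} (v : Vec ℤ n) → + 1 · v ≡ v
·-identityˡ v = ≡.trans (VecP.map-cong ℤP.*-identityˡ v) (VecP.map-id v)

·-zeroˡ : ∀ {n} (v : Vec ℤ n) → + 0 · v ≡ Vec.replicate n (+ 0)
·-zeroˡ []      = ≡.refl
·-zeroˡ (_ ∷ v) = cong (+ 0 ∷_) (·-zeroˡ v)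

·-zeroʳ : ∀ {n} k → k · Vec.replicate n (+ 0) ≡ Vec.replicate n (+ 0)
·-zeroʳ k = ≡.trans (VecP.map-replicate (k ℤ.*_) (+ 0) _) (cong (Vec.replicate _) (ℤP.*-zeroʳ k))

Imprimitive : ∀ {n} → Vec ℤ n → Set
Imprimitive v = Σ ℕ λ k → Σ (Vec ℤ _) λ w → 2 ℕ.≤ k × v ≡ + k · w

-- Writing m u = c v, either ∣m∣ divides ∣c∣, or ∣m∣ / gcd(∣m∣,∣c∣) ≥ 2 divides every entry of v.
multiple⊎imprimitive : ∀ {n} m c (u v : Vec ℤ n) → m ≢ + 0 → m · u ≡ c · v →
                       (Σ ℤ λ q → u ≡ q · v) ⊎ Imprimitive v
multiple⊎imprimitive m c u v m≢0 mu≡cv with ℤ.∣ m ∣ ℕD.∣? ℤ.∣ c ∣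
... | yes ∣m∣∣∣c∣ = inj₁ (q , cancel u v mu≡cv)
  where
  instance
    m≢0′ : ℤ.NonZero m
    m≢0′ = ℤ.≢-nonZero m≢0
  m∣c = ℤD.∣ᵤ⇒∣ {m} {c} ∣m∣∣∣c∣
  q = ℤD.quotient m∣c
  cancel : ∀ {n} (u v : Vec ℤ n) → m · u ≡ c · v → u ≡ q · v
  cancel []      []      _  = ≡.refl
  cancel (x ∷ u) (y ∷ v) eq with VecP.∷-injective eq
  ... | mx≡cy , rest = cong₂ _∷_ (ℤP.*-cancelˡ-≡ m x (q ℤ.* y) mx≡qmy) (cancel u v rest)
    where
    mx≡qmy : m ℤ.* x ≡ m ℤ.* (q ℤ.* y)
    mx≡qmy = ≡.trans mx≡cy (≡.trans (cong (ℤ._* y) (≡.trans (ℤD._∣_.equality m∣c) (ℤP.*-comm q m)))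
                                    (ℤP.*-assoc m q y))
... | no ∣m∣∤∣c∣ = inj₂ (k , proj₁ (divide u v mu≡cv) , k≥2 , proj₂ (divide u v mu≡cv))
  where
  ∣m∣≢0 : NonZero ℤ.∣ m ∣
  ∣m∣≢0 = ℕ.≢-nonZero (λ ∣m∣≡0 → m≢0 (ℤP.∣i∣≡0⇒i≡0 ∣m∣≡0))
  k = (ℤ.∣ m ∣ / gcd ℤ.∣ m ∣ ℤ.∣ c ∣) {{gcd-nonZero ℤ.∣ m ∣ ℤ.∣ c ∣ {{∣m∣≢0}}}}
  k≥2 : 2 ℕ.≤ k
  k≥2 = m/gcd[m,n]≥2 ℤ.∣ m ∣ ℤ.∣ c ∣ {{∣m∣≢0}} ∣m∣∤∣c∣
  divide : ∀ {n} (u v : Vec ℤ n) → m · u ≡ c · v → Σ (Vec ℤ n) λ w → v ≡ + k · w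
  divide []      []      _  = [] , ≡.refl
  divide (x ∷ u) (y ∷ v) eq with VecP.∷-injective eq
  ... | mx≡cy , rest with divide u v rest
  ... | w , v≡kw = ℤD.quotient k∣y ∷ w , cong₂ _∷_ (≡.trans (ℤD._∣_.equality k∣y) (ℤP.*-comm _ (+ k))) v≡kw
    where
    k∣y = ℤD.∣ᵤ⇒∣ {+ k} {y} (m*a≡n*b⇒m/gcd[m,n]∣b ℤ.∣ m ∣ ℤ.∣ c ∣ {{∣m∣≢0}}
            (≡.trans (≡.sym (ℤP.abs-* m x)) (≡.trans (cong ℤ.∣_∣ mx≡cy) (ℤP.abs-* c y))))

infixl 6 _⊞_ _⊟_ _⊖_
_⊞_ _⊟_ : ∀ {n} → Vec ℕ n → Vec ℕ n → Vec ℕ n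
a ⊞ b = Vec.zipWith ℕ._+_ a b
a ⊟ b = Vec.zipWith ℕ._∸_ a b

_⊖_ : ∀ {n} → Vec ℕ n → Vec ℕ n → Vec ℤ n
a ⊖ b = Vec.zipWith (λ x y → + x ℤ.- + y) a b

0ᵥ : ∀ {n} → Vec ℕ n
0ᵥ = Vec.replicate _ 0

scale : ∀ {n} → ℕ → Vec ℕ n → Vec ℕ n
scale k a = Vec.map (k ℕ.*_) a

module _ {n : ℕ} where

  ⊞-assoc : (a b e : Vec ℕ n) → a ⊞ b ⊞ e ≡ a ⊞ (b ⊞ e)
  ⊞-assoc = VecP.zipWith-assoc ℕP.+-assoc

  ⊞-comm : (a b : Vec ℕ n) → a ⊞ b ≡ b ⊞ a
  ⊞-comm = VecP.zipWith-comm ℕP.+-comm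

  ⊞-identityˡ : (a : Vec ℕ n) → 0ᵥ ⊞ a ≡ a
  ⊞-identityˡ = VecP.zipWith-identityˡ ℕP.+-identityˡ

  ⊞-identityʳ : (a : Vec ℕ n) → a ⊞ 0ᵥ ≡ a
  ⊞-identityʳ = VecP.zipWith-identityʳ ℕP.+-identityʳ

  ⊞-comm-middle : (a b e : Vec ℕ n) → a ⊞ (b ⊞ e) ≡ a ⊞ e ⊞ b
  ⊞-comm-middle a b e = ≡.trans (cong (a ⊞_) (⊞-comm b e)) (≡.sym (⊞-assoc a e b))

⊞-∸ : ∀ {n} (a b : Vec ℕ n) → a ⊞ b ⊟ a ≡ b
⊞-∸ []      []      = ≡.refl
⊞-∸ (x ∷ a) (y ∷ b) = cong₂ _∷_ (ℕP.m+n∸m≡n x y) (⊞-∸ a b)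

⊞-cancelˡ : ∀ {n} (a b e : Vec ℕ n) → a ⊞ b ≡ a ⊞ e → b ≡ e
⊞-cancelˡ a b e eq = ≡.trans (≡.sym (⊞-∸ a b)) (≡.trans (cong (_⊟ a) eq) (⊞-∸ a e))

scale-zero : ∀ {n} (a : Vec ℕ n) → scale 0 a ≡ 0ᵥ
scale-zero []      = ≡.refl
scale-zero (x ∷ a) = cong (0 ∷_) (scale-zero a)

scale-suc : ∀ {n} k (a : Vec ℕ n) → scale (suc k) a ≡ a ⊞ scale k a
scale-suc k []      = ≡.refl
scale-suc k (x ∷ a) = cong (_ ∷_) (scale-suc k a)

⊖≡0⇒≡ : ∀ {n} (a b : Vec ℕ n) → a ⊖ b ≡ Vec.replicate n (+ 0) → a ≡ b
⊖≡0⇒≡ []      []      _  = ≡.refl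
⊖≡0⇒≡ (x ∷ a) (y ∷ b) eq with VecP.∷-injective eq
... | x-y≡0 , rest = cong₂ _∷_ (ℤP.+-injective (ℤP.i-j≡0⇒i≡j _ _ x-y≡0)) (⊖≡0⇒≡ a b rest)

private
  swap-sign : ∀ x y {c} → x ℤ.- y ≡ ℤ.- c → y ℤ.- x ≡ c
  swap-sign x y {c} eq = ≡.trans (swap x y) (≡.trans (cong ℤ.-_ eq) (ℤP.neg-involutive c))
    where
    swap : ∀ x y → y ℤ.- x ≡ ℤ.- (x ℤ.- y)
    swap = solve-∀

  +*0 : ∀ x k → x ℕ.+ k ℕ.* 0 ≡ x
  +*0 x k = ≡.trans (cong (x ℕ.+_) (ℕP.*-zeroʳ k)) (ℕP.+-identityʳ x)

  +-split : ∀ {x y a} → + x ℤ.- + y ≡ + a → x ≡ y ℕ.+ a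
  +-split {x} {y} {a} x-y≡a = ℤP.+-injective (begin
    + x                   ≡⟨ x≡y+[x-y] (+ x) (+ y) ⟩
    + y ℤ.+ (+ x ℤ.- + y) ≡⟨ cong (ℤ._+_ (+ y)) x-y≡a ⟩
    + y ℤ.+ + a           ≡⟨ ℤP.pos-+ y a ⟨
    + (y ℕ.+ a)           ∎)
    where
    open ≡.≡-Reasoning
    x≡y+[x-y] : ∀ x y → x ≡ y ℤ.+ (x ℤ.- y)
    x≡y+[x-y] = solve-∀

⊖-anticomm : ∀ {n} (a b : Vec ℕ n) k (u : Vec ℤ n) → a ⊖ b ≡ -[1+ k ] · u → b ⊖ a ≡ + suc k · u
⊖-anticomm []      []      k []      _  = ≡.refl
⊖-anticomm (x ∷ a) (y ∷ b) k (z ∷ u) eq with VecP.∷-injective eq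
... | x-y≡-kz , rest =
  cong₂ _∷_ (swap-sign (+ x) (+ y) (≡.trans x-y≡-kz (≡.sym (ℤP.neg-distribˡ-* (+ suc k) z))))
            (⊖-anticomm a b k u rest)

addTo : ℕ → ℤ → ℕ
addTo n (+ k)    = n ℕ.+ k
addTo n -[1+ k ] = n ℕ.∸ suc k

+addTo : ∀ n r → ℤ.∣ r ∣ ℕ.≤ n → + addTo n r ≡ + n ℤ.+ r
+addTo n (+ k)    _   = ℤP.pos-+ n k
+addTo n -[1+ k ] k<n = ≡.sym (ℤP.⊖-≥ k<n)

‖_‖₁ : ∀ {n} → Vec ℤ n → ℕ
‖ [] ‖₁    = 0
‖ r ∷ R ‖₁ = ℤ.∣ r ∣ ℕ.+ ‖ R ‖₁

∣∣≤‖‖₁ : ∀ {n} (R : Vec ℤ n) → All (λ r → ℤ.∣ r ∣ ℕ.≤ ‖ R ‖₁) R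
∣∣≤‖‖₁ []      = []
∣∣≤‖‖₁ (r ∷ R) = ℕP.m≤m+n _ _ ∷ All.map (λ r≤ → ℕP.≤-trans r≤ (ℕP.m≤n+m _ _)) (∣∣≤‖‖₁ R)

-- Translating both endpoints by N·W makes room for the intermediate point b + N·W + R.
⊖-split : ∀ {n} (a b W : Vec ℕ n) N (T R : Vec ℤ n) → All (1 ℕ.≤_) W → All (λ r → ℤ.∣ r ∣ ℕ.≤ N) R →
          a ⊖ b ≡ Vec.zipWith ℤ._+_ T R →
          Σ (Vec ℕ n) λ δ → (a ⊞ scale N W ⊖ δ ≡ T) × (δ ⊖ (b ⊞ scale N W) ≡ R)
⊖-split [] [] [] N [] [] [] [] _ = [] , ≡.refl , ≡.refl
⊖-split (x ∷ a) (y ∷ b) (w ∷ W) N (t ∷ T) (r ∷ R) (1≤w ∷ 1≤W) (r≤N ∷ R≤N) eq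
  with VecP.∷-injective eq
... | x-y≡t+r , rest with ⊖-split a b W N T R 1≤W R≤N rest
... | δs , a⊖δs , δs⊖b = addTo y′ r ∷ δs , cong₂ _∷_ x′-δ≡t a⊖δs , cong₂ _∷_ δ-y′≡r δs⊖b
  where
  open ≡.≡-Reasoning
  y′ = y ℕ.+ N ℕ.* w
  δ≡y′+r : + addTo y′ r ≡ + y′ ℤ.+ r
  δ≡y′+r = +addTo y′ r (ℕP.≤-trans r≤N (ℕP.≤-trans (ℕP.m≤m*n N w {{ℕ.>-nonZero 1≤w}}) (ℕP.m≤n+m _ y)))
  δ-y′≡r : + addTo y′ r ℤ.- + y′ ≡ r
  δ-y′≡r = ≡.trans (cong (ℤ._- + y′) δ≡y′+r) (cancel (+ y′) r)
    where
    cancel : ∀ b r → b ℤ.+ r ℤ.- b ≡ r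
    cancel = solve-∀
  x′-δ≡t : + (x ℕ.+ N ℕ.* w) ℤ.- + addTo y′ r ≡ t
  x′-δ≡t = begin
    + (x ℕ.+ N ℕ.* w) ℤ.- + addTo y′ r
      ≡⟨ cong₂ ℤ._-_ (ℤP.pos-+ x _) (≡.trans δ≡y′+r (cong (ℤ._+ r) (ℤP.pos-+ y _))) ⟩
    + x ℤ.+ + (N ℕ.* w) ℤ.- (+ y ℤ.+ + (N ℕ.* w) ℤ.+ r) ≡⟨ shift (+ x) (+ y) (+ (N ℕ.* w)) r ⟩
    (+ x ℤ.- + y) ℤ.- r                     ≡⟨ cong (ℤ._- r) x-y≡t+r ⟩
    t ℤ.+ r ℤ.- r                           ≡⟨ cancel t r ⟩
    t                                       ∎
    where
    shift : ∀ x y s r → x ℤ.+ s ℤ.- (y ℤ.+ s ℤ.+ r) ≡ (x ℤ.- y) ℤ.- r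
    shift = solve-∀
    cancel : ∀ t r → t ℤ.+ r ℤ.- r ≡ t
    cancel = solve-∀

≡0⊎nonzero-entry : ∀ {n} (w : Vec ℤ n) → w ≡ Vec.replicate n (+ 0) ⊎ Σ (Fin n) λ j → Vec.lookup w j ≢ + 0
≡0⊎nonzero-entry []              = inj₁ ≡.refl
≡0⊎nonzero-entry (+ zero ∷ w)    with ≡0⊎nonzero-entry w
... | inj₁ w≡0        = inj₁ (cong (+ 0 ∷_) w≡0)
... | inj₂ (j , wⱼ≢0) = inj₂ (suc j , wⱼ≢0)
≡0⊎nonzero-entry (+ suc _ ∷ _)   = inj₂ (zero , λ ())
≡0⊎nonzero-entry (-[1+ _ ] ∷ _)  = inj₂ (zero , λ ())

module _ {c ℓ : Level} (K : ACF0 c ℓ) (d : ℕ) where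
  open Binomials K d
  open ACF0 K using (cring; 0≉1; algClosed)
  open CommutativeRing cring hiding (zero)
  open import Algebra.Properties.Ring ring using (-‿+-comm; -‿distribˡ-*; -1*x≈-x; -0#≈0#; ⁻¹-anti-homo‿-)
  open import Algebra.Properties.CommutativeSemigroup +-commutativeSemigroup
    using (x∙yz≈y∙xz) renaming (interchange to +-interchange)
  open import Algebra.Properties.CommutativeSemigroup *-commutativeSemigroup
    using () renaming (interchange to *-interchange)
  open import Algebra.Properties.Semiring.Exp semiring using (_^_; ^-homo-*; ^-assocʳ; ^-congˡ; ^-congʳ)
  open import Algebra.Properties.Group +-group using () renaming (x∙y⁻¹≈ε⇒x≈y to x-y≈0⇒x≈y; x≈y⇒x∙y⁻¹≈ε to x≈y⇒x-y≈0)
  import Relation.Binary.Reasoning.Setoid setoid as ≈-Reasoning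

  infix 8 _⁺ _⁻
  _⁺ _⁻ : ∀ {n} → Vec ℤ n → Vec ℕ n
  u ⁺ = Vec.map posPart u
  u ⁻ = Vec.map negPart u

  ⁺⊖⁻ : ∀ {n} (u : Vec ℤ n) → u ⁺ ⊖ u ⁻ ≡ u
  ⁺⊖⁻ []            = ≡.refl
  ⁺⊖⁻ (+ x ∷ u)     = cong₂ _∷_ (ℤP.+-identityʳ (+ x)) (⁺⊖⁻ u)
  ⁺⊖⁻ (-[1+ x ] ∷ u) = cong (-[1+ x ] ∷_) (⁺⊖⁻ u)

  private
    ⊖-coordinate : ∀ x y k z → + x ℤ.- + y ≡ + k ℤ.* z →
                   Σ ℕ λ g → x ≡ g ℕ.+ k ℕ.* posPart z × y ≡ g ℕ.+ k ℕ.* negPart z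
    ⊖-coordinate x y k (+ m) x-y≡km =
      y , +-split (≡.trans x-y≡km (≡.sym (ℤP.pos-* k m))) , ≡.sym (+*0 y k)
    ⊖-coordinate x y k -[1+ m ] x-y≡-km =
      x , ≡.sym (+*0 x k) , +-split (begin
        + y ℤ.- + x          ≡⟨ swap-sign (+ x) (+ y) (≡.trans x-y≡-km (≡.sym (ℤP.neg-distribʳ-* (+ k) (+ suc m)))) ⟩
        + k ℤ.* + suc m      ≡⟨ ℤP.pos-* k (suc m) ⟨
        + (k ℕ.* suc m)      ∎)
      where open ≡.≡-Reasoning

  ⊖≡+k·⇒shifted : ∀ {n} (a b : Vec ℕ n) k (u : Vec ℤ n) → a ⊖ b ≡ + k · u →
                  Σ (Vec ℕ n) λ g → a ≡ g ⊞ scale k (u ⁺) × b ≡ g ⊞ scale k (u ⁻)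
  ⊖≡+k·⇒shifted []      []      k []      _  = [] , ≡.refl , ≡.refl
  ⊖≡+k·⇒shifted (x ∷ a) (y ∷ b) k (z ∷ u) eq
    with ⊖-coordinate x y k z (proj₁ (VecP.∷-injective eq)) | ⊖≡+k·⇒shifted a b k u (proj₂ (VecP.∷-injective eq))
  ... | g , x≡ , y≡ | gs , a≡ , b≡ = g ∷ gs , cong₂ _∷_ x≡ a≡ , cong₂ _∷_ y≡ b≡

  ·-⁺ : ∀ {n} k (w : Vec ℤ n) → (+ k · w) ⁺ ≡ scale k (w ⁺)
  ·-⁺ k       []             = ≡.refl
  ·-⁺ k       (+ m ∷ w)      = cong₂ _∷_ (cong posPart (≡.sym (ℤP.pos-* k m))) (·-⁺ k w)
  ·-⁺ zero    (-[1+ m ] ∷ w) = cong (0 ∷_) (·-⁺ zero w)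
  ·-⁺ (suc k) (-[1+ m ] ∷ w) = cong₂ _∷_ (≡.sym (ℕP.*-zeroʳ k)) (·-⁺ (suc k) w)

  ·-⁻ : ∀ {n} k (w : Vec ℤ n) → (+ k · w) ⁻ ≡ scale k (w ⁻)
  ·-⁻ k       []             = ≡.refl
  ·-⁻ k       (+ m ∷ w)      =
    cong₂ _∷_ (≡.trans (cong negPart (≡.sym (ℤP.pos-* k m))) (≡.sym (ℕP.*-zeroʳ k))) (·-⁻ k w)
  ·-⁻ zero    (-[1+ m ] ∷ w) = cong (0 ∷_) (·-⁻ zero w)
  ·-⁻ (suc k) (-[1+ m ] ∷ w) = cong (_ ∷_) (·-⁻ (suc k) w)

  positive⇒⁻≡0 : ∀ {n} (v : Vec ℤ n) → All (+ 0 ℤ.<_) v → v ⁻ ≡ 0ᵥ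
  positive⇒⁻≡0 []        []              = ≡.refl
  positive⇒⁻≡0 (+ _ ∷ v) (ℤ.+<+ _ ∷ v>0) = cong (0 ∷_) (positive⇒⁻≡0 v v>0)

  positive⇒⁺≥1 : ∀ {n} (v : Vec ℤ n) → All (+ 0 ℤ.<_) v → All (1 ℕ.≤_) (v ⁺)
  positive⇒⁺≥1 []            []              = []
  positive⇒⁺≥1 (+ suc _ ∷ v) (ℤ.+<+ _ ∷ v>0) = s≤s z≤n ∷ positive⇒⁺≥1 v v>0

  -- Polynomial arithmetic

  coeff-∷ : ∀ a e p α → coeff ((a , e) ∷ p) α ≈ a * coeff (mono e) α + coeff p α
  coeff-∷ a e p α with VecP.≡-dec ℕ._≟_ e α
  ... | yes _ = +-cong (sym (trans (*-congˡ (+-identityʳ 1#)) (*-identityʳ a))) refl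
  ... | no _  = sym (trans (+-congʳ (zeroʳ a)) (+-identityˡ _))

  coeff-∷-≢ : ∀ a e p {α} → e ≢ α → coeff ((a , e) ∷ p) α ≈ coeff p α
  coeff-∷-≢ a e p {α} e≢α with VecP.≡-dec ℕ._≟_ e α
  ... | yes e≡α = ⊥-elim (e≢α e≡α)
  ... | no _    = refl

  coeff-++ : ∀ p q α → coeff (p ++ q) α ≈ coeff p α + coeff q α
  coeff-++ []            q α = sym (+-identityˡ _)
  coeff-++ ((a , e) ∷ p) q α = begin
    coeff ((a , e) ∷ (p ++ q)) α                   ≈⟨ coeff-∷ a e (p ++ q) α ⟩
    a * coeff (mono e) α + coeff (p ++ q) α        ≈⟨ +-congˡ (coeff-++ p q α) ⟩
    a * coeff (mono e) α + (coeff p α + coeff q α) ≈⟨ +-assoc _ _ _ ⟨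
    a * coeff (mono e) α + coeff p α + coeff q α   ≈⟨ +-congʳ (coeff-∷ a e p α) ⟨
    coeff ((a , e) ∷ p) α + coeff q α              ∎
    where open ≈-Reasoning

  coeff-neg : ∀ p α → coeff (-ₚ p) α ≈ - coeff p α
  coeff-neg []            α = sym -0#≈0#
  coeff-neg ((a , e) ∷ p) α = begin
    coeff ((- a , e) ∷ (-ₚ p)) α              ≈⟨ coeff-∷ (- a) e (-ₚ p) α ⟩
    - a * coeff (mono e) α + coeff (-ₚ p) α   ≈⟨ +-cong (sym (-‿distribˡ-* a _)) (coeff-neg p α) ⟩
    - (a * coeff (mono e) α) + - coeff p α    ≈⟨ -‿+-comm _ _ ⟩
    - (a * coeff (mono e) α + coeff p α)      ≈⟨ -‿cong (coeff-∷ a e p α) ⟨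
    - coeff ((a , e) ∷ p) α                   ∎
    where open ≈-Reasoning

  coeff-binom : ∀ α β γ → coeff (binom α β) γ ≈ coeff (mono α) γ - coeff (mono β) γ
  coeff-binom α β γ = begin
    coeff (mono α ++ (-ₚ mono β)) γ               ≈⟨ coeff-++ (mono α) (-ₚ mono β) γ ⟩
    coeff (mono α) γ + coeff (-ₚ mono β) γ        ≈⟨ +-congˡ (coeff-neg (mono β) γ) ⟩
    coeff (mono α) γ - coeff (mono β) γ           ∎
    where open ≈-Reasoning

  +-minus-telescope : ∀ a b c → (a - b) + (b - c) ≈ a - c
  +-minus-telescope a b c = begin
    (a - b) + (b - c)   ≈⟨ +-assoc a (- b) (b - c) ⟩
    a + (- b + (b - c)) ≈⟨ +-congˡ (+-assoc (- b) b (- c)) ⟨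
    a + ((- b + b) - c) ≈⟨ +-congˡ (+-congʳ (-‿inverseˡ b)) ⟩
    a + (0# - c)        ≈⟨ +-congˡ (+-identityˡ (- c)) ⟩
    a - c               ∎
    where open ≈-Reasoning

  ++-congₚ : ∀ {p p′ q q′} → p ≈ₚ p′ → q ≈ₚ q′ → p ++ q ≈ₚ p′ ++ q′
  ++-congₚ {p} {p′} {q} {q′} p≈p′ q≈q′ α =
    trans (coeff-++ p q α) (trans (+-cong (p≈p′ α) (q≈q′ α)) (sym (coeff-++ p′ q′ α)))

  infix 4 _≋_
  _≋_ : Poly → Poly → Set (c ⊔ ℓ)
  _≋_ = Pointwise (×-Pointwise _≈_ _≡_)

  ≋⇒≈ₚ : ∀ {p q} → p ≋ q → p ≈ₚ q
  ≋⇒≈ₚ []                                      α = refl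
  ≋⇒≈ₚ (_∷_ {a , e} {b , .e} (a≈b , ≡.refl) p≋q) α =
    trans (coeff-∷ a e _ α) (trans (+-cong (*-congʳ a≈b) (≋⇒≈ₚ p≋q α)) (sym (coeff-∷ b e _ α)))

  infixl 7 _*ₜ_
  _*ₜ_ : Carrier × Exp → Carrier × Exp → Carrier × Exp
  s *ₜ t = proj₁ s * proj₁ t , proj₂ s ⊞ proj₂ t

  coeff-map-*ₜ : ∀ a β {δ α} q → β ⊞ δ ≡ α → coeff (List.map ((a , β) *ₜ_) q) α ≈ a * coeff q δ
  coeff-map-*ₜ a β         []            _ = sym (zeroʳ a)
  coeff-map-*ₜ a β {δ} {α} ((b , γ) ∷ q) β+δ≡α with VecP.≡-dec ℕ._≟_ (β ⊞ γ) α | VecP.≡-dec ℕ._≟_ γ δ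
  ... | yes _       | yes _      = trans (+-congˡ (coeff-map-*ₜ a β q β+δ≡α)) (sym (distribˡ a _ _))
  ... | yes β+γ≡α   | no γ≢δ     = ⊥-elim (γ≢δ (⊞-cancelˡ β γ δ (≡.trans β+γ≡α (≡.sym β+δ≡α))))
  ... | no β+γ≢α    | yes ≡.refl = ⊥-elim (β+γ≢α β+δ≡α)
  ... | no _        | no _       = coeff-map-*ₜ a β q β+δ≡α

  coeff-map-*ₜ-∉ : ∀ a β {α} q → (∀ γ → β ⊞ γ ≢ α) → coeff (List.map ((a , β) *ₜ_) q) α ≈ 0#
  coeff-map-*ₜ-∉ a β     []            _     = refl
  coeff-map-*ₜ-∉ a β {α} ((b , γ) ∷ q) β+≢α with VecP.≡-dec ℕ._≟_ (β ⊞ γ) α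
  ... | yes β+γ≡α = ⊥-elim (β+≢α γ β+γ≡α)
  ... | no _      = coeff-map-*ₜ-∉ a β q β+≢α

  map-*ₜ-cong : ∀ s {q q′} → q ≈ₚ q′ → List.map (s *ₜ_) q ≈ₚ List.map (s *ₜ_) q′
  map-*ₜ-cong (a , β) {q} {q′} q≈q′ α with VecP.≡-dec ℕ._≟_ (β ⊞ (α ⊟ β)) α
  ... | yes β+δ≡α =
    trans (coeff-map-*ₜ a β q β+δ≡α) (trans (*-congˡ (q≈q′ _)) (sym (coeff-map-*ₜ a β q′ β+δ≡α)))
  ... | no β+δ≢α  = trans (coeff-map-*ₜ-∉ a β q β+≢α) (sym (coeff-map-*ₜ-∉ a β q′ β+≢α))
    where
    β+≢α : ∀ γ → β ⊞ γ ≢ α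
    β+≢α γ β+γ≡α = β+δ≢α (≡.trans (cong (β ⊞_) (≡.trans (cong (_⊟ β) (≡.sym β+γ≡α)) (⊞-∸ β γ))) β+γ≡α)

  *ₚ-congˡ : ∀ p {q q′} → q ≈ₚ q′ → p *ₚ q ≈ₚ p *ₚ q′
  *ₚ-congˡ []      _   α = refl
  *ₚ-congˡ (s ∷ p) {q} {q′} q≈q′ α = begin
    coeff (List.map (s *ₜ_) q ++ p *ₚ q) α           ≈⟨ coeff-++ (List.map (s *ₜ_) q) (p *ₚ q) α ⟩
    coeff (List.map (s *ₜ_) q) α + coeff (p *ₚ q) α  ≈⟨ +-cong (map-*ₜ-cong s {q} {q′} q≈q′ α)
                                                                (*ₚ-congˡ p {q} {q′} q≈q′ α) ⟩
    coeff (List.map (s *ₜ_) q′) α + coeff (p *ₚ q′) α ≈⟨ coeff-++ (List.map (s *ₜ_) q′) (p *ₚ q′) α ⟨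
    coeff (List.map (s *ₜ_) q′ ++ p *ₚ q′) α         ∎
    where open ≈-Reasoning

  *ₚ-zeroʳ : ∀ p → p *ₚ 0ₚ ≡ 0ₚ
  *ₚ-zeroʳ []      = ≡.refl
  *ₚ-zeroʳ (s ∷ p) = *ₚ-zeroʳ p

  *ₚ-distribʳ : ∀ p p′ q → (p ++ p′) *ₚ q ≡ p *ₚ q ++ p′ *ₚ q
  *ₚ-distribʳ []      p′ q = ≡.refl
  *ₚ-distribʳ (s ∷ p) p′ q = ≡.trans (cong (List.map (s *ₜ_) q ++_) (*ₚ-distribʳ p p′ q))
                                     (≡.sym (ListP.++-assoc (List.map (s *ₜ_) q) (p *ₚ q) (p′ *ₚ q)))

  *ₚ-distribˡ : ∀ p q r → p *ₚ (q ++ r) ≈ₚ p *ₚ q ++ p *ₚ r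
  *ₚ-distribˡ []      q r α = refl
  *ₚ-distribˡ (s ∷ p) q r α rewrite ListP.map-++ (s *ₜ_) q r = begin
    coeff ((sq ++ sr) ++ p *ₚ (q ++ r)) α                  ≈⟨ coeff-++ (sq ++ sr) _ α ⟩
    coeff (sq ++ sr) α + coeff (p *ₚ (q ++ r)) α           ≈⟨ +-cong (coeff-++ sq sr α) (*ₚ-distribˡ p q r α) ⟩
    coeff sq α + coeff sr α + coeff (p *ₚ q ++ p *ₚ r) α   ≈⟨ +-congˡ (coeff-++ (p *ₚ q) _ α) ⟩
    coeff sq α + coeff sr α + (coeff (p *ₚ q) α + coeff (p *ₚ r) α)
      ≈⟨ +-interchange _ _ _ _ ⟩
    coeff sq α + coeff (p *ₚ q) α + (coeff sr α + coeff (p *ₚ r) α)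
      ≈⟨ +-cong (coeff-++ sq _ α) (coeff-++ sr _ α) ⟨
    coeff (sq ++ p *ₚ q) α + coeff (sr ++ p *ₚ r) α        ≈⟨ coeff-++ (sq ++ p *ₚ q) _ α ⟨
    coeff ((sq ++ p *ₚ q) ++ (sr ++ p *ₚ r)) α             ∎
    where
    open ≈-Reasoning
    sq = List.map (s *ₜ_) q
    sr = List.map (s *ₜ_) r

  map-*ₜ-assoc : ∀ s t p → List.map (s *ₜ_) (List.map (t *ₜ_) p) ≋ List.map ((s *ₜ t) *ₜ_) p
  map-*ₜ-assoc s t []      = []
  map-*ₜ-assoc s t (u ∷ p) = (sym (*-assoc _ _ _) , ≡.sym (⊞-assoc (proj₂ s) (proj₂ t) (proj₂ u)))
                             ∷ map-*ₜ-assoc s t p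

  map-*ₜ-*ₚ : ∀ s q p → List.map (s *ₜ_) (q *ₚ p) ≋ List.map (s *ₜ_) q *ₚ p
  map-*ₜ-*ₚ s []      p = []
  map-*ₜ-*ₚ s (t ∷ q) p rewrite ListP.map-++ (s *ₜ_) (List.map (t *ₜ_) p) (q *ₚ p) =
    Pointwise.++⁺ (map-*ₜ-assoc s t p) (map-*ₜ-*ₚ s q p)

  *ₚ-assoc : ∀ h q p → h *ₚ (q *ₚ p) ≋ (h *ₚ q) *ₚ p
  *ₚ-assoc []      q p = []
  *ₚ-assoc (s ∷ h) q p rewrite *ₚ-distribʳ (List.map (s *ₜ_) q) (h *ₚ q) p =
    Pointwise.++⁺ (map-*ₜ-*ₚ s q p) (*ₚ-assoc h q p)

  constant-*ₚ : ∀ a p → ((a , 0ᵥ) ∷ []) *ₚ p ≋ List.map (λ t → a * proj₁ t , proj₂ t) p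
  constant-*ₚ a p rewrite ListP.++-identityʳ (List.map ((a , 0ᵥ) *ₜ_) p) = go p
    where
    go : ∀ p → List.map ((a , 0ᵥ) *ₜ_) p ≋ List.map (λ t → a * proj₁ t , proj₂ t) p
    go []      = []
    go (t ∷ p) = (refl , ⊞-identityˡ (proj₂ t)) ∷ go p

  *ₚ-identityˡ : ∀ p → 1ₚ *ₚ p ≈ₚ p
  *ₚ-identityˡ p α = trans (≋⇒≈ₚ (constant-*ₚ 1# p) α) (≋⇒≈ₚ (go p) α)
    where
    go : ∀ p → List.map (λ t → 1# * proj₁ t , proj₂ t) p ≋ p
    go []      = []
    go (t ∷ p) = (*-identityˡ _ , ≡.refl) ∷ go p

  -1*ₚ : ∀ p → ((- 1# , 0ᵥ) ∷ []) *ₚ p ≈ₚ -ₚ p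
  -1*ₚ p α = trans (≋⇒≈ₚ (constant-*ₚ (- 1#) p) α) (≋⇒≈ₚ (go p) α)
    where
    go : ∀ p → List.map (λ t → - 1# * proj₁ t , proj₂ t) p ≋ -ₚ p
    go []      = []
    go (t ∷ p) = (-1*x≈-x _ , ≡.refl) ∷ go p

  mono-*ₚ-binom : ∀ γ α β → mono γ *ₚ binom α β ≋ binom (γ ⊞ α) (γ ⊞ β)
  mono-*ₚ-binom γ α β = (*-identityˡ 1# , ≡.refl) ∷ (*-identityˡ (- 1#) , ≡.refl) ∷ []

  sumₚ-++ : ∀ ps qs → sumₚ (ps ++ qs) ≡ sumₚ ps ++ sumₚ qs
  sumₚ-++ []       qs = ≡.refl
  sumₚ-++ (p ∷ ps) qs = ≡.trans (cong (p ++_) (sumₚ-++ ps qs)) (≡.sym (ListP.++-assoc p (sumₚ ps) (sumₚ qs)))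

  -- Ideals and the binomial congruence

  combination : ∀ {g} {G : Poly → Set g} → List (Poly × Σ Poly G) → Poly
  combination cs = sumₚ (List.map (λ t → proj₁ t *ₚ proj₁ (proj₂ t)) cs)

  module Ideal {g} (G : Poly → Set g) where

    ⟨⟩-resp-≈ₚ : ∀ f f′ → f ≈ₚ f′ → ⟨ G ⟩ f′ → ⟨ G ⟩ f
    ⟨⟩-resp-≈ₚ f f′ f≈f′ (cs , f′≈cs) = cs , λ α → trans (f≈f′ α) (f′≈cs α)

    ⟨⟩-0ₚ : ⟨ G ⟩ 0ₚ
    ⟨⟩-0ₚ = [] , λ α → refl

    ⟨⟩-++ : ∀ f f′ → ⟨ G ⟩ f → ⟨ G ⟩ f′ → ⟨ G ⟩ (f ++ f′)
    ⟨⟩-++ f f′ (cs , f≈cs) (cs′ , f′≈cs′) = cs ++ cs′ , λ α → begin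
      coeff (f ++ f′) α                                     ≈⟨ ++-congₚ {f} {combination cs} {f′} f≈cs f′≈cs′ α ⟩
      coeff (combination cs ++ combination cs′) α           ≡⟨ cong (λ p → coeff p α) (≡.sym combination-++) ⟩
      coeff (combination (cs ++ cs′)) α                     ∎
      where
      open ≈-Reasoning
      term : Poly × Σ Poly G → Poly
      term t = proj₁ t *ₚ proj₁ (proj₂ t)
      combination-++ : combination (cs ++ cs′) ≡ combination cs ++ combination cs′
      combination-++ = ≡.trans (cong sumₚ (ListP.map-++ term cs cs′)) (sumₚ-++ (List.map term cs) _)

    ⟨⟩-*ₚ : ∀ h f → ⟨ G ⟩ f → ⟨ G ⟩ (h *ₚ f)
    ⟨⟩-*ₚ h f (cs , f≈cs) = multiplied cs , λ α → trans (*ₚ-congˡ h {f} f≈cs α) (h*combination cs α)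
      where
      open ≈-Reasoning
      multiplied : List (Poly × Σ Poly G) → List (Poly × Σ Poly G)
      multiplied = List.map (λ t → h *ₚ proj₁ t , proj₂ t)
      h*combination : ∀ cs → h *ₚ combination cs ≈ₚ combination (multiplied cs)
      h*combination []                   rewrite *ₚ-zeroʳ h = λ α → refl
      h*combination ((hᵢ , gᵢ , _) ∷ cs) α = begin
        coeff (h *ₚ (hᵢ *ₚ gᵢ ++ combination cs)) α
          ≈⟨ *ₚ-distribˡ h (hᵢ *ₚ gᵢ) (combination cs) α ⟩
        coeff (h *ₚ (hᵢ *ₚ gᵢ) ++ h *ₚ combination cs) α
          ≈⟨ ++-congₚ {h *ₚ (hᵢ *ₚ gᵢ)} {(h *ₚ hᵢ) *ₚ gᵢ} {h *ₚ combination cs}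
                      (≋⇒≈ₚ (*ₚ-assoc h hᵢ gᵢ)) (h*combination cs) α ⟩
        coeff ((h *ₚ hᵢ) *ₚ gᵢ ++ combination (multiplied cs)) α ∎

    ⟨⟩-neg : ∀ f → ⟨ G ⟩ f → ⟨ G ⟩ (-ₚ f)
    ⟨⟩-neg f f∈ = ⟨⟩-resp-≈ₚ (-ₚ f) (-1ₚ *ₚ f) (λ α → sym (-1*ₚ f α)) (⟨⟩-*ₚ -1ₚ f f∈)
      where -1ₚ = (- 1# , 0ᵥ) ∷ []

    ⟨⟩-gen : ∀ f → G f → ⟨ G ⟩ f
    ⟨⟩-gen f f∈G = ((1ₚ , f , f∈G) ∷ []) , λ α → begin
      coeff f α                   ≈⟨ *ₚ-identityˡ f α ⟨
      coeff (1ₚ *ₚ f) α           ≡⟨ cong (λ p → coeff p α) (ListP.++-identityʳ (1ₚ *ₚ f)) ⟨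
      coeff (1ₚ *ₚ f ++ []) α     ∎
      where open ≈-Reasoning

    ⟨⟩-least : ∀ {h} (H : Poly → Set h) → (∀ f → H f → ⟨ G ⟩ f) → ∀ f → ⟨ H ⟩ f → ⟨ G ⟩ f
    ⟨⟩-least H H⊆⟨G⟩ f (cs , f≈cs) = ⟨⟩-resp-≈ₚ f (combination {G = H} cs) f≈cs (go cs)
      where
      go : ∀ cs → ⟨ G ⟩ (combination {G = H} cs)
      go []                   = ⟨⟩-0ₚ
      go ((hᵢ , gᵢ , gᵢ∈H) ∷ cs) = ⟨⟩-++ (hᵢ *ₚ gᵢ) _ (⟨⟩-*ₚ hᵢ gᵢ (H⊆⟨G⟩ gᵢ gᵢ∈H)) (go cs)

  ⟨⟩-≐ : ∀ {g h} (G : Poly → Set g) (H : Poly → Set h) →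
         (∀ f → G f → ⟨ H ⟩ f) → (∀ f → H f → ⟨ G ⟩ f) → ⟨ G ⟩ ≐ ⟨ H ⟩
  ⟨⟩-≐ G H G⊆⟨H⟩ H⊆⟨G⟩ f = Ideal.⟨⟩-least H G G⊆⟨H⟩ f , Ideal.⟨⟩-least G H H⊆⟨G⟩ f

  module Congruence {g} (G : Poly → Set g) where
    open Ideal G

    infix 4 _~_
    record _~_ (α β : Exp) : Set (c ⊔ ℓ ⊔ g) where
      constructor mk~
      field binom∈⟨G⟩ : ⟨ G ⟩ (binom α β)
    open _~_ public

    ~-reflexive : ∀ {α β} → α ≡ β → α ~ β
    ~-reflexive {α} ≡.refl = mk~ (⟨⟩-resp-≈ₚ (binom α α) 0ₚ (λ γ → trans (coeff-binom α α γ) (-‿inverseʳ _)) ⟨⟩-0ₚ)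

    ~-sym : ∀ {α β} → α ~ β → β ~ α
    ~-sym {α} {β} (mk~ α~β) = mk~ (⟨⟩-resp-≈ₚ (binom β α) (-ₚ binom α β) swap (⟨⟩-neg (binom α β) α~β))
      where
      open ≈-Reasoning
      swap : binom β α ≈ₚ -ₚ binom α β
      swap γ = begin
        coeff (binom β α) γ                       ≈⟨ coeff-binom β α γ ⟩
        coeff (mono β) γ - coeff (mono α) γ       ≈⟨ ⁻¹-anti-homo‿- _ _ ⟨
        - (coeff (mono α) γ - coeff (mono β) γ)   ≈⟨ -‿cong (coeff-binom α β γ) ⟨
        - coeff (binom α β) γ                     ≈⟨ coeff-neg (binom α β) γ ⟨
        coeff (-ₚ binom α β) γ                    ∎

    ~-trans : ∀ {α β γ} → α ~ β → β ~ γ → α ~ γ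
    ~-trans {α} {β} {γ} (mk~ α~β) (mk~ β~γ) =
      mk~ (⟨⟩-resp-≈ₚ (binom α γ) (binom α β ++ binom β γ) telescope (⟨⟩-++ (binom α β) (binom β γ) α~β β~γ))
      where
      open ≈-Reasoning
      telescope : binom α γ ≈ₚ binom α β ++ binom β γ
      telescope δ = begin
        coeff (binom α γ) δ                                     ≈⟨ coeff-binom α γ δ ⟩
        coeff (mono α) δ - coeff (mono γ) δ                     ≈⟨ +-minus-telescope _ _ _ ⟨
        (coeff (mono α) δ - coeff (mono β) δ) + (coeff (mono β) δ - coeff (mono γ) δ)
          ≈⟨ +-cong (coeff-binom α β δ) (coeff-binom β γ δ) ⟨
        coeff (binom α β) δ + coeff (binom β γ) δ               ≈⟨ coeff-++ (binom α β) (binom β γ) δ ⟨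
        coeff (binom α β ++ binom β γ) δ                        ∎

    ~-shift : ∀ γ {α β} → α ~ β → γ ⊞ α ~ γ ⊞ β
    ~-shift γ {α} {β} (mk~ α~β) =
      mk~ (⟨⟩-resp-≈ₚ (binom (γ ⊞ α) (γ ⊞ β)) (mono γ *ₚ binom α β)
            (λ δ → sym (≋⇒≈ₚ (mono-*ₚ-binom γ α β) δ)) (⟨⟩-*ₚ (mono γ) (binom α β) α~β))

    ~-setoid : Setoid _ _
    ~-setoid = record
      { Carrier       = Exp
      ; _≈_           = _~_
      ; isEquivalence = record { refl = ~-reflexive ≡.refl ; sym = ~-sym ; trans = ~-trans }
      }

    import Relation.Binary.Reasoning.Setoid ~-setoid as ~-Reasoning

    ~-scale : ∀ k {α β} → α ~ β → scale k α ~ scale k β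
    ~-scale zero    {α} {β} _   = ~-reflexive (≡.trans (scale-zero α) (≡.sym (scale-zero β)))
    ~-scale (suc k) {α} {β} α~β = begin
      scale (suc k) α   ≡⟨ scale-suc k α ⟩
      α ⊞ scale k α     ≈⟨ ~-shift α (~-scale k α~β) ⟩
      α ⊞ scale k β     ≡⟨ ⊞-comm α (scale k β) ⟩
      scale k β ⊞ α     ≈⟨ ~-shift (scale k β) α~β ⟩
      scale k β ⊞ β     ≡⟨ ⊞-comm (scale k β) β ⟩
      β ⊞ scale k β     ≡⟨ scale-suc k β ⟨
      scale (suc k) β   ∎
      where open ~-Reasoning

    ~-multiple : ∀ {u} → u ⁺ ~ u ⁻ → ∀ a b c → a ⊖ b ≡ c · u → a ~ b
    ~-multiple {u} u⁺~u⁻ a b (+ k) a-b≡ku with ⊖≡+k·⇒shifted a b k u a-b≡ku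
    ... | g , a≡ , b≡ = begin
      a                   ≡⟨ a≡ ⟩
      g ⊞ scale k (u ⁺)   ≈⟨ ~-shift g (~-scale k u⁺~u⁻) ⟩
      g ⊞ scale k (u ⁻)   ≡⟨ b≡ ⟨
      b                   ∎
      where open ~-Reasoning
    ~-multiple {u} u⁺~u⁻ a b -[1+ k ] a-b≡-ku =
      ~-sym (~-multiple u⁺~u⁻ b a (+ suc k) (⊖-anticomm a b k u a-b≡-ku))

    ~-⊞-scale : ∀ {W} → W ~ 0ᵥ → ∀ N γ → γ ⊞ scale N W ~ γ
    ~-⊞-scale {W} W~0 zero    γ = ~-reflexive (≡.trans (cong (γ ⊞_) (scale-zero W)) (⊞-identityʳ γ))
    ~-⊞-scale {W} W~0 (suc N) γ = begin
      γ ⊞ scale (suc N) W     ≡⟨ cong (γ ⊞_) (scale-suc N W) ⟩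
      γ ⊞ (W ⊞ scale N W)     ≡⟨ ⊞-comm-middle γ W (scale N W) ⟩
      γ ⊞ scale N W ⊞ W       ≈⟨ ~-shift (γ ⊞ scale N W) W~0 ⟩
      γ ⊞ scale N W ⊞ 0ᵥ      ≡⟨ ⊞-identityʳ _ ⟩
      γ ⊞ scale N W           ≈⟨ ~-⊞-scale W~0 N γ ⟩
      γ                       ∎
      where open ~-Reasoning

    ~-lincomb : ∀ {W} → All (1 ℕ.≤_) W → W ~ 0ᵥ → ∀ {m} (us : Fin m → ZVec) → (∀ i → us i ⁺ ~ us i ⁻) →
                ∀ cs a b → a ⊖ b ≡ lincomb cs us → a ~ b
    ~-lincomb     W≥1 W~0 {zero}  us us⁺~us⁻ cs a b a⊖b≡0 = ~-reflexive (⊖≡0⇒≡ a b a⊖b≡0)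
    ~-lincomb {W} W≥1 W~0 {suc m} us us⁺~us⁻ cs a b a⊖b≡ = begin
      a               ≈⟨ ~-⊞-scale W~0 N a ⟨
      a ⊞ scale N W   ≈⟨ ~-multiple (us⁺~us⁻ zero) (a ⊞ scale N W) δ (cs zero) (proj₁ (proj₂ split)) ⟩
      δ               ≈⟨ ~-lincomb W≥1 W~0 (λ i → us (suc i)) (λ i → us⁺~us⁻ (suc i)) (λ i → cs (suc i))
                                   δ (b ⊞ scale N W) (proj₂ (proj₂ split)) ⟩
      b ⊞ scale N W   ≈⟨ ~-⊞-scale W~0 N b ⟩
      b               ∎
      where
      open ~-Reasoning
      R = lincomb (λ i → cs (suc i)) (λ i → us (suc i))
      N = ‖ R ‖₁
      split = ⊖-split a b W N (cs zero · us zero) R W≥1 (∣∣≤‖‖₁ R) a⊖b≡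
      δ = proj₁ split

  -- Evaluation at the point whose j-th coordinate is t and whose other coordinates are 1.
  module EvalAt (j : Fin d) (t : Carrier) where

    evalMono : Exp → Carrier
    evalMono e = t ^ Vec.lookup e j

    eval : Poly → Carrier
    eval []            = 0#
    eval ((a , e) ∷ f) = a * evalMono e + eval f

    eval-++ : ∀ p q → eval (p ++ q) ≈ eval p + eval q
    eval-++ []            q = sym (+-identityˡ _)
    eval-++ ((a , e) ∷ p) q = trans (+-congˡ (eval-++ p q)) (sym (+-assoc _ _ _))

    eval-neg : ∀ p → eval (-ₚ p) ≈ - eval p
    eval-neg []            = sym -0#≈0#
    eval-neg ((a , e) ∷ p) = trans (+-cong (sym (-‿distribˡ-* a _)) (eval-neg p)) (-‿+-comm _ _)

    evalMono-⊞ : ∀ e e′ → evalMono (e ⊞ e′) ≈ evalMono e * evalMono e′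
    evalMono-⊞ e e′ rewrite VecP.lookup-zipWith ℕ._+_ j e e′ = ^-homo-* t (Vec.lookup e j) (Vec.lookup e′ j)

    eval-map-*ₜ : ∀ a e q → eval (List.map ((a , e) *ₜ_) q) ≈ (a * evalMono e) * eval q
    eval-map-*ₜ a e []             = sym (zeroʳ _)
    eval-map-*ₜ a e ((b , e′) ∷ q) = begin
      (a * b) * evalMono (e ⊞ e′) + eval (List.map ((a , e) *ₜ_) q)
        ≈⟨ +-cong (*-congˡ (evalMono-⊞ e e′)) (eval-map-*ₜ a e q) ⟩
      (a * b) * (evalMono e * evalMono e′) + (a * evalMono e) * eval q
        ≈⟨ +-congʳ (*-interchange a b (evalMono e) (evalMono e′)) ⟩
      (a * evalMono e) * (b * evalMono e′) + (a * evalMono e) * eval q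
        ≈⟨ distribˡ _ _ _ ⟨
      (a * evalMono e) * (b * evalMono e′ + eval q) ∎
      where open ≈-Reasoning

    eval-*ₚ : ∀ p q → eval (p *ₚ q) ≈ eval p * eval q
    eval-*ₚ []            q = sym (zeroˡ _)
    eval-*ₚ ((a , e) ∷ p) q = begin
      eval (List.map ((a , e) *ₜ_) q ++ p *ₚ q)         ≈⟨ eval-++ (List.map ((a , e) *ₜ_) q) (p *ₚ q) ⟩
      eval (List.map ((a , e) *ₜ_) q) + eval (p *ₚ q)   ≈⟨ +-cong (eval-map-*ₜ a e q) (eval-*ₚ p q) ⟩
      (a * evalMono e) * eval q + eval p * eval q       ≈⟨ distribʳ _ _ _ ⟨
      (a * evalMono e + eval p) * eval q                ∎
      where open ≈-Reasoning

    eval-1ₚ : eval 1ₚ ≈ 1#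
    eval-1ₚ rewrite VecP.lookup-replicate j 0 = trans (+-identityʳ _) (*-identityˡ 1#)

    drop : Exp → Poly → Poly
    drop β []            = []
    drop β ((a , e) ∷ f) with VecP.≡-dec ℕ._≟_ e β
    ... | yes _ = drop β f
    ... | no _  = (a , e) ∷ drop β f

    eval-drop : ∀ β f → eval f ≈ coeff f β * evalMono β + eval (drop β f)
    eval-drop β []            = sym (trans (+-congʳ (zeroˡ _)) (+-identityˡ _))
    eval-drop β ((a , e) ∷ f) with VecP.≡-dec ℕ._≟_ e β
    ... | yes ≡.refl = trans (+-congˡ (eval-drop β f))
                         (trans (sym (+-assoc _ _ _)) (+-congʳ (sym (distribʳ (evalMono β) a (coeff f β)))))
    ... | no _       = trans (+-congˡ (eval-drop β f)) (x∙yz≈y∙xz _ _ _)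

    coeff-drop-≡ : ∀ β f → coeff (drop β f) β ≈ 0#
    coeff-drop-≡ β []            = refl
    coeff-drop-≡ β ((a , e) ∷ f) with VecP.≡-dec ℕ._≟_ e β
    ... | yes _   = coeff-drop-≡ β f
    ... | no e≢β  = trans (coeff-∷-≢ a e (drop β f) e≢β) (coeff-drop-≡ β f)

    coeff-drop-≢ : ∀ β f {γ} → γ ≢ β → coeff (drop β f) γ ≈ coeff f γ
    coeff-drop-≢ β []            γ≢β = refl
    coeff-drop-≢ β ((a , e) ∷ f) γ≢β with VecP.≡-dec ℕ._≟_ e β
    ... | yes ≡.refl = trans (coeff-drop-≢ β f γ≢β) (sym (coeff-∷-≢ a e f (λ e≡γ → γ≢β (≡.sym e≡γ))))
    ... | no _       = trans (coeff-∷ a e (drop β f) _)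
                         (trans (+-congˡ (coeff-drop-≢ β f γ≢β)) (sym (coeff-∷ a e f _)))

    length-drop : ∀ β f → length (drop β f) ℕ.≤ length f
    length-drop β []            = z≤n
    length-drop β ((a , e) ∷ f) with VecP.≡-dec ℕ._≟_ e β
    ... | yes _ = ℕP.m≤n⇒m≤1+n (length-drop β f)
    ... | no _  = s≤s (length-drop β f)

    drop-head : ∀ a e f → drop e ((a , e) ∷ f) ≡ drop e f
    drop-head a e f with VecP.≡-dec ℕ._≟_ e e
    ... | yes _   = ≡.refl
    ... | no e≢e  = ⊥-elim (e≢e ≡.refl)

    eval-≈ₚ0 : ∀ f → f ≈ₚ 0ₚ → eval f ≈ 0#
    eval-≈ₚ0 f = go (length f) f ℕP.≤-refl
      where
      go : ∀ n f → length f ℕ.≤ n → f ≈ₚ 0ₚ → eval f ≈ 0#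
      go n       []            _         _   = refl
      go (suc n) ((a , e) ∷ f) (s≤s len) f≈0 = begin
        eval ((a , e) ∷ f)                                         ≈⟨ eval-drop e ((a , e) ∷ f) ⟩
        coeff ((a , e) ∷ f) e * evalMono e + eval (drop e ((a , e) ∷ f))
          ≈⟨ +-cong (trans (*-congʳ (f≈0 e)) (zeroˡ _)) (reflexive (cong eval (drop-head a e f))) ⟩
        0# + eval (drop e f)                                       ≈⟨ +-identityˡ _ ⟩
        eval (drop e f)
          ≈⟨ go n (drop e f) (ℕP.≤-trans (length-drop e f) len) drop≈0 ⟩
        0#                                                         ∎
        where
        open ≈-Reasoning
        drop≈0 : drop e f ≈ₚ 0ₚ
        drop≈0 γ with VecP.≡-dec ℕ._≟_ γ e
        ... | yes ≡.refl = coeff-drop-≡ e f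
        ... | no γ≢e     =
          trans (coeff-drop-≢ e f γ≢e) (trans (sym (coeff-∷-≢ a e f (λ e≡γ → γ≢e (≡.sym e≡γ)))) (f≈0 γ))

    eval-cong : ∀ {f g} → f ≈ₚ g → eval f ≈ eval g
    eval-cong {f} {g} f≈g = x-y≈0⇒x≈y (eval f) (eval g) (begin
      eval f - eval g           ≈⟨ +-congˡ (eval-neg g) ⟨
      eval f + eval (-ₚ g)      ≈⟨ eval-++ f (-ₚ g) ⟨
      eval (f ++ (-ₚ g))        ≈⟨ eval-≈ₚ0 (f ++ (-ₚ g)) f-g≈0 ⟩
      0#                        ∎)
      where
      open ≈-Reasoning
      f-g≈0 : f ++ (-ₚ g) ≈ₚ 0ₚ
      f-g≈0 γ = trans (coeff-++ f (-ₚ g) γ) (trans (+-cong (f≈g γ) (coeff-neg g γ)) (-‿inverseʳ _))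

    unit⇒eval≉0 : ∀ f → unit f → ¬ (eval f ≈ 0#)
    unit⇒eval≉0 f (h , fh≈1) evalf≈0 = 0≉1 (begin
      0#                ≈⟨ zeroˡ (eval h) ⟨
      0# * eval h       ≈⟨ *-congʳ evalf≈0 ⟨
      eval f * eval h   ≈⟨ eval-*ₚ f h ⟨
      eval (f *ₚ h)     ≈⟨ eval-cong {f *ₚ h} {1ₚ} fh≈1 ⟩
      eval 1ₚ           ≈⟨ eval-1ₚ ⟩
      1#                ∎)
      where open ≈-Reasoning

  -- Factorisation of x^(kA) − x^(kB)

  module Cofactor (A B : Exp) where

    E : ℕ → ℕ → Exp
    E i j = scale i A ⊞ scale j B

    -- cofactor i j = Σ_{l ≤ j} x^(E (i + l) (j - l))
    cofactor : ℕ → ℕ → Poly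
    cofactor i zero    = mono (E i 0)
    cofactor i (suc j) = (1# , E i (suc j)) ∷ cofactor (suc i) j

    A⊞E : ∀ i j → A ⊞ E i j ≡ E (suc i) j
    A⊞E i j = ≡.sym (≡.trans (cong (_⊞ scale j B) (scale-suc i A)) (⊞-assoc A (scale i A) (scale j B)))

    B⊞E : ∀ i j → B ⊞ E i j ≡ E i (suc j)
    B⊞E i j = ≡.sym (begin
      scale i A ⊞ scale (suc j) B   ≡⟨ cong (scale i A ⊞_) (scale-suc j B) ⟩
      scale i A ⊞ (B ⊞ scale j B)   ≡⟨ ⊞-assoc (scale i A) B (scale j B) ⟨
      scale i A ⊞ B ⊞ scale j B     ≡⟨ cong (_⊞ scale j B) (⊞-comm (scale i A) B) ⟩
      B ⊞ scale i A ⊞ scale j B     ≡⟨ ⊞-assoc B (scale i A) (scale j B) ⟩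
      B ⊞ E i j                     ∎)
      where open ≡.≡-Reasoning

    module _ (γ : Exp) where
      private
        χ : Exp → Carrier
        χ e = coeff (mono e) γ

        χ-cong : ∀ {e e′} → e ≡ e′ → χ e ≈ χ e′
        χ-cong e≡e′ = reflexive (cong χ e≡e′)

        X Y : Poly → Carrier
        X L = coeff (List.map ((1# , A) *ₜ_) L) γ
        Y L = coeff (List.map ((- 1# , B) *ₜ_) L) γ

        coeff-binom-*ₚ : ∀ L → coeff (binom A B *ₚ L) γ ≈ X L + Y L
        coeff-binom-*ₚ L = trans (coeff-++ (List.map ((1# , A) *ₜ_) L) _ γ)
                                 (+-congˡ (trans (coeff-++ (List.map ((- 1# , B) *ₜ_) L) [] γ) (+-identityʳ _)))

        X-∷ : ∀ e L → X ((1# , e) ∷ L) ≈ χ (A ⊞ e) + X L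
        X-∷ e L = trans (coeff-∷ (1# * 1#) (A ⊞ e) _ γ) (+-congʳ (trans (*-congʳ (*-identityˡ 1#)) (*-identityˡ _)))

        Y-∷ : ∀ e L → Y ((1# , e) ∷ L) ≈ - χ (B ⊞ e) + Y L
        Y-∷ e L = trans (coeff-∷ (- 1# * 1#) (B ⊞ e) _ γ) (+-congʳ (trans (*-congʳ (*-identityʳ (- 1#))) (-1*x≈-x _)))

        telescope : ∀ i j → X (cofactor i j) + Y (cofactor i j) ≈ χ (E (suc i ℕ.+ j) 0) - χ (E i (suc j))
        telescope i zero = begin
          X (mono (E i 0)) + Y (mono (E i 0))   ≈⟨ +-cong (trans (X-∷ (E i 0) []) (+-identityʳ _))
                                                          (trans (Y-∷ (E i 0) []) (+-identityʳ _)) ⟩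
          χ (A ⊞ E i 0) - χ (B ⊞ E i 0)
            ≈⟨ +-cong (χ-cong (≡.trans (A⊞E i 0) (cong (λ m → E (suc m) 0) (≡.sym (ℕP.+-identityʳ i)))))
                      (-‿cong (χ-cong (B⊞E i 0))) ⟩
          χ (E (suc i ℕ.+ 0) 0) - χ (E i 1)     ∎
          where open ≈-Reasoning
        telescope i (suc j) = begin
          X (cofactor i (suc j)) + Y (cofactor i (suc j))
            ≈⟨ +-cong (X-∷ (E i (suc j)) (cofactor (suc i) j)) (Y-∷ (E i (suc j)) (cofactor (suc i) j)) ⟩
          (χ (A ⊞ E i (suc j)) + X (cofactor (suc i) j)) + (- χ (B ⊞ E i (suc j)) + Y (cofactor (suc i) j))
            ≈⟨ +-interchange _ _ _ _ ⟩
          (χ (A ⊞ E i (suc j)) - χ (B ⊞ E i (suc j))) + (X (cofactor (suc i) j) + Y (cofactor (suc i) j))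
            ≈⟨ +-cong (+-cong (χ-cong (A⊞E i (suc j))) (-‿cong (χ-cong (B⊞E i (suc j))))) (telescope (suc i) j) ⟩
          (χ (E (suc i) (suc j)) - χ (E i (suc (suc j)))) + (χ (E (suc (suc i) ℕ.+ j) 0) - χ (E (suc i) (suc j)))
            ≈⟨ +-comm _ _ ⟩
          (χ (E (suc (suc i) ℕ.+ j) 0) - χ (E (suc i) (suc j))) + (χ (E (suc i) (suc j)) - χ (E i (suc (suc j))))
            ≈⟨ +-minus-telescope _ _ _ ⟩
          χ (E (suc (suc i) ℕ.+ j) 0) - χ (E i (suc (suc j)))
            ≈⟨ +-congʳ (χ-cong (cong (λ m → E (suc m) 0) (≡.sym (ℕP.+-suc i j)))) ⟩
          χ (E (suc i ℕ.+ suc j) 0) - χ (E i (suc (suc j))) ∎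
          where open ≈-Reasoning

      binom-*ₚ-cofactor : ∀ i j →
                          coeff (binom A B *ₚ cofactor i j) γ ≈ coeff (binom (E (suc i ℕ.+ j) 0) (E i (suc j))) γ
      binom-*ₚ-cofactor i j = trans (coeff-binom-*ₚ (cofactor i j))
        (trans (telescope i j) (sym (coeff-binom (E (suc i ℕ.+ j) 0) (E i (suc j)) γ)))

    binom-scale-factorises : ∀ n → binom (scale (suc n) A) (scale (suc n) B) ≈ₚ binom A B *ₚ cofactor 0 n
    binom-scale-factorises n γ = trans (reflexive (cong (λ p → coeff p γ) (cong₂ binom nA≡E nB≡E)))
                                       (sym (binom-*ₚ-cofactor γ 0 n))
      where
      nA≡E : scale (suc n) A ≡ E (suc n) 0
      nA≡E = ≡.sym (≡.trans (cong (scale (suc n) A ⊞_) (scale-zero B)) (⊞-identityʳ _))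
      nB≡E : scale (suc n) B ≡ E 0 (suc n)
      nB≡E = ≡.sym (≡.trans (cong (_⊞ scale (suc n) B) (scale-zero A)) (⊞-identityˡ _))

  geometric : Carrier → ℕ → Carrier
  geometric z m = evalU cring (List.replicate m 1#) z

  geometric-suc : ∀ z m → z ^ m + geometric z m ≈ geometric z (suc m)
  geometric-suc z zero    = trans (+-identityʳ 1#) (sym (trans (+-congˡ (zeroʳ z)) (+-identityʳ 1#)))
  geometric-suc z (suc m) = begin
    z * z ^ m + (1# + z * geometric z m)   ≈⟨ x∙yz≈y∙xz _ _ _ ⟩
    1# + (z * z ^ m + z * geometric z m)   ≈⟨ +-congˡ (distribˡ z _ _) ⟨
    1# + z * (z ^ m + geometric z m)       ≈⟨ +-congˡ (*-congˡ (geometric-suc z m)) ⟩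
    1# + z * geometric z (suc m)           ∎
    where open ≈-Reasoning

  private
    1#≉0# : ¬ (1# ≈ 0#)
    1#≉0# 1≈0 = 0≉1 (sym 1≈0)

  ∃-geometric≈0 : ∀ m → Σ Carrier λ ζ → geometric ζ (suc (suc m)) ≈ 0#
  ∃-geometric≈0 m with algClosed (List.replicate (suc m) 1#) 1# (s≤s z≤n) 1#≉0#
  ... | ζ , root = ζ , trans (reflexive (cong (λ cs → evalU cring cs ζ) (≡.sym (replicate-snoc (suc m))))) root
    where
    replicate-snoc : ∀ n → List.replicate n 1# ++ 1# ∷ [] ≡ List.replicate (suc n) 1#
    replicate-snoc zero    = ≡.refl
    replicate-snoc (suc n) = cong (1# ∷_) (replicate-snoc n)

  ∃-root : ∀ a ζ → Σ Carrier λ t → t ^ suc a ≈ ζ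
  ∃-root a ζ with algClosed (- ζ ∷ List.replicate a 0#) 1# (s≤s z≤n) 1#≉0#
  ... | t , root = t , x-y≈0⇒x≈y _ ζ (begin
    t ^ suc a - ζ                                        ≈⟨ +-comm _ _ ⟩
    - ζ + t * t ^ a                                      ≈⟨ +-congˡ (*-congˡ (monomial a)) ⟨
    - ζ + t * evalU cring (List.replicate a 0# ++ 1# ∷ []) t ≈⟨ root ⟩
    0#                                                   ∎)
    where
    open ≈-Reasoning
    monomial : ∀ a → evalU cring (List.replicate a 0# ++ 1# ∷ []) t ≈ t ^ a
    monomial zero    = trans (+-congˡ (zeroʳ t)) (+-identityʳ 1#)
    monomial (suc a) = trans (+-identityˡ _) (*-congˡ (monomial a))

  1#^n≈1# : ∀ n → 1# ^ n ≈ 1#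
  1#^n≈1# zero    = refl
  1#^n≈1# (suc n) = trans (*-identityˡ _) (1#^n≈1# n)

  module _ (j : Fin d) where

    binom-nonunit : ∀ α β → ¬ unit (binom α β)
    binom-nonunit α β α-β-unit = unit⇒eval≉0 (binom α β) α-β-unit (begin
      1# * evalMono α + (- 1# * evalMono β + 0#) ≈⟨ +-cong (*-identityˡ _) (trans (+-identityʳ _) (-1*x≈-x _)) ⟩
      evalMono α - evalMono β
        ≈⟨ +-cong (1#^n≈1# (Vec.lookup α j)) (-‿cong (1#^n≈1# (Vec.lookup β j))) ⟩
      1# - 1#                                    ≈⟨ -‿inverseʳ 1# ⟩
      0#                                         ∎)
      where
      open EvalAt j 1#
      open ≈-Reasoning

  module _ (A B : Exp) (j : Fin d) (t ζ : Carrier) where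
    open Cofactor A B
    open EvalAt j t

    geometric-1 : geometric ζ 1 ≈ 1#
    geometric-1 = trans (+-congˡ (zeroʳ ζ)) (+-identityʳ 1#)

    eval-cofactor-row : (∀ i l → evalMono (E i l) ≈ ζ ^ i) → ∀ i m → eval (cofactor i m) ≈ ζ ^ i * geometric ζ (suc m)
    eval-cofactor-row ev i zero    = begin
      1# * evalMono (E i 0) + 0#    ≈⟨ trans (+-identityʳ _) (trans (*-identityˡ _) (ev i 0)) ⟩
      ζ ^ i                         ≈⟨ trans (*-congˡ geometric-1) (*-identityʳ _) ⟨
      ζ ^ i * geometric ζ 1         ∎
      where open ≈-Reasoning
    eval-cofactor-row ev i (suc m) = begin
      1# * evalMono (E i (suc m)) + eval (cofactor (suc i) m)
        ≈⟨ +-cong (trans (*-identityˡ _) (ev i (suc m))) (eval-cofactor-row ev (suc i) m) ⟩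
      ζ ^ i + (ζ * ζ ^ i) * geometric ζ (suc m)
        ≈⟨ +-cong (*-identityʳ _) (trans (sym (*-assoc _ ζ _)) (*-congʳ (*-comm _ ζ))) ⟨
      ζ ^ i * 1# + ζ ^ i * (ζ * geometric ζ (suc m))
        ≈⟨ distribˡ _ _ _ ⟨
      ζ ^ i * geometric ζ (suc (suc m)) ∎
      where open ≈-Reasoning

    eval-cofactor-column : (∀ i l → evalMono (E i l) ≈ ζ ^ l) → ∀ i m → eval (cofactor i m) ≈ geometric ζ (suc m)
    eval-cofactor-column ev i zero    = trans (+-identityʳ _) (trans (*-identityˡ _) (trans (ev i 0) (sym geometric-1)))
    eval-cofactor-column ev i (suc m) =
      trans (+-cong (trans (*-identityˡ _) (ev i (suc m))) (eval-cofactor-column ev (suc i) m)) (geometric-suc ζ (suc m))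

  ^-*-root : ∀ {t ζ} a → t ^ suc a ≈ ζ → ∀ i → t ^ (i ℕ.* suc a) ≈ ζ ^ i
  ^-*-root {t} a tᵃ⁺¹≈ζ i =
    trans (^-congʳ t (ℕP.*-comm i (suc a))) (trans (sym (^-assocʳ t (suc a) i)) (^-congˡ i tᵃ⁺¹≈ζ))

  module _ (j : Fin d) (w : ZVec) where
    open Cofactor (w ⁺) (w ⁻)

    lookup-E : ∀ i l → Vec.lookup (E i l) j ≡ i ℕ.* posPart (Vec.lookup w j) ℕ.+ l ℕ.* negPart (Vec.lookup w j)
    lookup-E i l rewrite VecP.lookup-zipWith ℕ._+_ j (scale i (w ⁺)) (scale l (w ⁻))
                       | VecP.lookup-map j (i ℕ.*_) (w ⁺) | VecP.lookup-map j (l ℕ.*_) (w ⁻)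
                       | VecP.lookup-map j posPart w | VecP.lookup-map j negPart w = ≡.refl

    -- At a point where t^|w_j| is a root ζ of 1 + z + ⋯ + z^(n+1), the cofactor evaluates to a multiple of that sum.
    cofactor-nonunit : Vec.lookup w j ≢ + 0 → ∀ n → ¬ unit (cofactor 0 (suc n))
    cofactor-nonunit wⱼ≢0 n with ∃-geometric≈0 n | Vec.lookup w j in wⱼ≡
    ... | _ , _      | + zero   = ⊥-elim (wⱼ≢0 ≡.refl)
    ... | ζ , ζ-root | + suc a with ∃-root a ζ
    ...   | t , tᵃ⁺¹≈ζ = λ u → unit⇒eval≉0 (cofactor 0 (suc n)) u
                         (trans (eval-cofactor-row (w ⁺) (w ⁻) j t ζ row 0 (suc n)) (trans (*-identityˡ _) ζ-root))
      where
      open EvalAt j t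
      row : ∀ i l → evalMono (E i l) ≈ ζ ^ i
      row i l rewrite lookup-E i l | wⱼ≡ | ℕP.*-zeroʳ l | ℕP.+-identityʳ (i ℕ.* suc a) = ^-*-root a tᵃ⁺¹≈ζ i
    cofactor-nonunit wⱼ≢0 n | ζ , ζ-root | -[1+ a ] with ∃-root a ζ
    ...   | t , tᵃ⁺¹≈ζ = λ u → unit⇒eval≉0 (cofactor 0 (suc n)) u
                         (trans (eval-cofactor-column (w ⁺) (w ⁻) j t ζ column 0 (suc n)) ζ-root)
      where
      open EvalAt j t
      column : ∀ i l → evalMono (E i l) ≈ ζ ^ l
      column i l rewrite lookup-E i l | wⱼ≡ | ℕP.*-zeroʳ i = ^-*-root a tᵃ⁺¹≈ζ l

  canonical∧irreducible⇒primitive : ∀ α β → IsCanonical α β → Irreducible (binom α β) → ¬ Imprimitive (α ⊖ β)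
  canonical∧irreducible⇒primitive α β canonical (p≉0 , _ , factors) (suc (suc n) , w , s≤s (s≤s z≤n) , v≡kw)
    with ≡0⊎nonzero-entry w
  ... | inj₁ w≡0 = p≉0 (λ γ → trans (coeff-binom α β γ) (x≈y⇒x-y≈0 (reflexive (cong (λ e → coeff (mono e) γ) α≡β))))
    where
    α≡β : α ≡ β
    α≡β = ⊖≡0⇒≡ α β (≡.trans v≡kw (≡.trans (cong (+ suc (suc n) ·_) w≡0) (·-zeroʳ (+ suc (suc n)))))
  ... | inj₂ (j , wⱼ≢0) = [ binom-nonunit j (w ⁺) (w ⁻) , cofactor-nonunit j w wⱼ≢0 n ]
                            (factors (binom (w ⁺) (w ⁻)) (Cofactor.cofactor (w ⁺) (w ⁻) 0 (suc n)) factorisation)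
    where
    k = suc (suc n)
    factorisation : binom α β ≈ₚ binom (w ⁺) (w ⁻) *ₚ Cofactor.cofactor (w ⁺) (w ⁻) 0 (suc n)
    factorisation γ = begin
      coeff (binom α β) γ                                ≈⟨ canonical γ ⟩
      coeff (binom ((α ⊖ β) ⁺) ((α ⊖ β) ⁻)) γ            ≡⟨ cong (λ v → coeff (binom (v ⁺) (v ⁻)) γ) v≡kw ⟩
      coeff (binom ((+ k · w) ⁺) ((+ k · w) ⁻)) γ        ≡⟨ cong₂ (λ a b → coeff (binom a b) γ) (·-⁺ k w) (·-⁻ k w) ⟩
      coeff (binom (scale k (w ⁺)) (scale k (w ⁻))) γ    ≈⟨ Cofactor.binom-scale-factorises (w ⁺) (w ⁻) (suc n) γ ⟩
      coeff (binom (w ⁺) (w ⁻) *ₚ Cofactor.cofactor (w ⁺) (w ⁻) 0 (suc n)) γ ∎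
      where open ≈-Reasoning

  -- Lattice ideals

  basis : ∀ {k} → Fin k → Fin k → ℤ
  basis zero    zero    = + 1
  basis zero    (suc _) = + 0
  basis (suc _) zero    = + 0
  basis (suc i) (suc j) = basis i j

  lincomb-zero : ∀ {k} (vs : Fin k → ZVec) → lincomb (λ _ → + 0) vs ≡ Vec.replicate d (+ 0)
  lincomb-zero {zero}  vs = ≡.refl
  lincomb-zero {suc k} vs = ≡.trans (cong₂ (Vec.zipWith ℤ._+_) (·-zeroˡ (vs zero)) (lincomb-zero (λ i → vs (suc i))))
                                    (VecP.zipWith-identityˡ ℤP.+-identityˡ _)

  lincomb-basis : ∀ {k} (vs : Fin k → ZVec) i → lincomb (basis i) vs ≡ vs i
  lincomb-basis {suc k} vs zero    =
    ≡.trans (cong₂ (Vec.zipWith ℤ._+_) (·-identityˡ (vs zero)) (lincomb-zero (λ i → vs (suc i))))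
            (VecP.zipWith-identityʳ ℤP.+-identityʳ _)
  lincomb-basis {suc k} vs (suc i) =
    ≡.trans (cong₂ (Vec.zipWith ℤ._+_) (·-zeroˡ (vs zero)) (lincomb-basis (λ j → vs (suc j)) i))
            (VecP.zipWith-identityˡ ℤP.+-identityˡ _)

  lincomb-single : (cs : Fin 1 → ℤ) (vs : Fin 1 → ZVec) → lincomb cs vs ≡ cs zero · vs zero
  lincomb-single cs vs = VecP.zipWith-identityʳ ℤP.+-identityʳ _

  Span⊆Sat : ∀ {L : ZVec → Set} {u} → L u → Sat L u
  Span⊆Sat {L} {u} u∈L = + 1 , (λ ()) , ≡.subst L (≡.sym (·-identityˡ u)) u∈L

  LatticeBinomial : (ZVec → Set) → Poly → Set c
  LatticeBinomial L f = Σ Exp λ α → Σ Exp λ β → L (expVec α β) × f ≡ binom α β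

  module _ (αs βs : Fin 1 → Exp) (canonical : IsCanonical (αs zero) (βs zero)) where
    private
      α = αs zero
      β = βs zero
      vs = λ i → expVec (αs i) (βs i)
      v  = vs zero

      Generator : Poly → Set c
      Generator f = Σ (Fin 1) λ i → f ≡ binom (αs i) (βs i)

      open Ideal Generator
      open Congruence Generator

      v⁺~v⁻ : v ⁺ ~ v ⁻
      v⁺~v⁻ = mk~ (⟨⟩-resp-≈ₚ (canBinom v) (binom α β) (λ γ → sym (canonical γ)) (⟨⟩-gen (binom α β) (zero , ≡.refl)))

      generator∈ : ∀ {L : ZVec → Set} → L v → ∀ f → Generator f → ⟨ LatticeBinomial L ⟩ f
      generator∈ {L} v∈L f (zero , ≡.refl) = Ideal.⟨⟩-gen (LatticeBinomial L) f (α , β , v∈L , ≡.refl)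

      v∈Span : Span vs v
      v∈Span = basis zero , ≡.sym (lincomb-basis vs zero)

    principal-≐ : BinIdeal αs βs ≐ I[ Span vs ]
    principal-≐ = ⟨⟩-≐ Generator (LatticeBinomial (Span vs)) (generator∈ {Span vs} v∈Span) lattice∈
      where
      lattice∈ : ∀ f → LatticeBinomial (Span vs) f → ⟨ Generator ⟩ f
      lattice∈ f (a , b , (cs , a⊖b≡) , ≡.refl) =
        binom∈⟨G⟩ (~-multiple v⁺~v⁻ a b (cs zero) (≡.trans a⊖b≡ (lincomb-single cs vs)))

    saturation-≐ : Irreducible (binom α β) → BinIdeal αs βs ≐ I[ Sat (Span vs) ]
    saturation-≐ irreducible = ⟨⟩-≐ Generator (LatticeBinomial (Sat (Span vs)))
                                   (generator∈ {Sat (Span vs)} (Span⊆Sat {Span vs} v∈Span)) saturation∈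
      where
      saturation∈ : ∀ f → LatticeBinomial (Sat (Span vs)) f → ⟨ Generator ⟩ f
      saturation∈ f (a , b , (m , m≢0 , cs , m[a⊖b]≡) , ≡.refl)
        with multiple⊎imprimitive m (cs zero) (a ⊖ b) v m≢0 (≡.trans m[a⊖b]≡ (lincomb-single cs vs))
      ... | inj₁ (q , a⊖b≡qv) = binom∈⟨G⟩ (~-multiple v⁺~v⁻ a b q a⊖b≡qv)
      ... | inj₂ imprimitive  = ⊥-elim (canonical∧irreducible⇒primitive α β canonical irreducible imprimitive)

  module _ (k : ℕ) (αs βs : Fin k → Exp) (i₀ : Fin k) (positive : Positive (expVec (αs i₀) (βs i₀))) where
    private
      vs = λ i → expVec (αs i) (βs i)

      Generator : Poly → Set c
      Generator f = Σ (Fin k) λ i → f ≡ canBinom (vs i)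

      open Ideal Generator
      open Congruence Generator

      vᵢ⁺~vᵢ⁻ : ∀ i → vs i ⁺ ~ vs i ⁻
      vᵢ⁺~vᵢ⁻ i = mk~ (⟨⟩-gen (canBinom (vs i)) (i , ≡.refl))

      W~0 : vs i₀ ⁺ ~ 0ᵥ
      W~0 = ≡.subst (vs i₀ ⁺ ~_) (positive⇒⁻≡0 (vs i₀) positive) (vᵢ⁺~vᵢ⁻ i₀)

    canonical-≐ : CanIdeal vs ≐ I[ Span vs ]
    canonical-≐ = ⟨⟩-≐ Generator (LatticeBinomial (Span vs)) generator∈ lattice∈
      where
      generator∈ : ∀ f → Generator f → ⟨ LatticeBinomial (Span vs) ⟩ f
      generator∈ f (i , ≡.refl) = Ideal.⟨⟩-gen (LatticeBinomial (Span vs)) f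
        (vs i ⁺ , vs i ⁻ , (basis i , ≡.trans (⁺⊖⁻ (vs i)) (≡.sym (lincomb-basis vs i))) , ≡.refl)
      lattice∈ : ∀ f → LatticeBinomial (Span vs) f → ⟨ Generator ⟩ f
      lattice∈ f (a , b , (cs , a⊖b≡) , ≡.refl) =
        binom∈⟨G⟩ (~-lincomb (positive⇒⁺≥1 (vs i₀) positive) W~0 vs vᵢ⁺~vᵢ⁻ cs a b a⊖b≡)

proposition5p5 : ∀ {c ℓ : Level} (K : ACF0 c ℓ) (d : ℕ) → let open Binomials K d in
    -- (1) k = 1, I = ⟨p⟩ with p = x^α - x^β canonical
    (∀ (αs βs : Fin 1 → Exp) → IsCanonical (αs zero) (βs zero) →
      let L = Span (λ i → expVec (αs i) (βs i)) in
      (BinIdeal αs βs ≐ I[ L ])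
      × (Irreducible (binom (αs zero) (βs zero)) → BinIdeal αs βs ≐ I[ Sat L ]))
    ×
    -- (2) some p_i has exponent vector in ℤ_{>0}^d ⇒ J = I_L
    (∀ (k : ℕ) (αs βs : Fin k → Exp) →
      Σ (Fin k) (λ i → Positive (expVec (αs i) (βs i))) →
      let vs = λ i → expVec (αs i) (βs i) in
      CanIdeal vs ≐ I[ Span vs ])
proposition5p5 K d =
  (λ αs βs canonical → principal-≐ K d αs βs canonical , saturation-≐ K d αs βs canonical) ,
  (λ k αs βs (i₀ , positive) → canonical-≐ K d k αs βs i₀ positive)
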